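{- Let $n\geq 4$ and $\rho=\alpha(n-1)n\in S_n$, where $\alpha$ is a permutation of $\{1,\dots,n-2\}$. Then $\mathrm{psb}^{ -1}(\mathrm{Av}(\rho))$ is not a permutation class.
   Context: A permutation contains a pattern $\rho\in S_k$ if some length-$k$ subsequence has entries in the same relative order as $\rho$; $\mathrm{Av}(\rho)$ is the set of all permutations avoiding $\rho$. A permutation class is a set of permutations closed under taking patterns. The algorithm PSB processes $\pi=\pi_1\cdots\pi_n$ from left to right with one pop stack $S$ (initially empty; PUSH puts an element on top, POP removes all elements appending them to the output from top to bottom) and an initially empty output: for $i=1,\dots,n$, if $S$ is empty or $\pi_i=\mathrm{TOP}(S)-1$ (where $\mathrm{TOP}(S)$ is the top element of $S$), push $\pi_i$; else if $\pi_i<\mathrm{TOP}(S)-1$, append $\pi_i$ directly to the output (bypass); otherwise pop $S$ and then push $\pi_i$. After all entries are processed, pop $S$. The output is $\mathrm{psb}(\pi)$, and $\mathrm{psb}^{ -1}(\mathcal{D})=\{\pi:\mathrm{psb}(\pi)\in\mathcal{D}\}$. -}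

module Defs where

open import Data.Nat using (ℕ; suc; _<_; _≤_; _∸_)
open import Data.Nat.Properties using (_≟_; _<?_)
open import Data.List using (List; []; _∷_; _++_; [_]; map; upTo; length; lookup)
open import Data.List.Relation.Binary.Permutation.Propositional using (_↭_)
open import Data.List.Relation.Binary.Sublist.Propositional using (_⊆_)
open import Data.Fin using (Fin; cast)
open import Data.Product using (Σ; ∃; _×_; _,_)
open import Function.Bundles using (_⇔_)
open import Relation.Binary.PropositionalEquality using (_≡_)
open import Relation.Nullary using (¬_; yes; no)

IsPerm : List ℕ → Set
IsPerm xs = xs ↭ map suc (upTo (length xs))

OrderIso : List ℕ → List ℕ → Set
OrderIso xs ys = Σ (length xs ≡ length ys) λ eq →
  ∀ i j → (lookup xs i < lookup xs j) ⇔ (lookup ys (cast eq i) < lookup ys (cast eq j))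

Contains : List ℕ → List ℕ → Set
Contains π ρ = ∃ λ σ → σ ⊆ π × OrderIso σ ρ

Avoids : List ℕ → List ℕ → Set
Avoids π ρ = ¬ Contains π ρ

-- The PSB algorithm.  The stack is a list with its top at the head;
-- popping appends the stack to the output from top to bottom.
psbGo : List ℕ → List ℕ → List ℕ → List ℕ
psbGo stack out [] = out ++ stack
psbGo [] out (x ∷ xs) = psbGo [ x ] out xs
psbGo (t ∷ st) out (x ∷ xs) with suc x ≟ t
... | yes _ = psbGo (x ∷ t ∷ st) out xs
... | no _ with suc x <? t
...   | yes _ = psbGo (t ∷ st) (out ++ [ x ]) xs
...   | no _ = psbGo [ x ] (out ++ (t ∷ st)) xs

psb : List ℕ → List ℕ
psb π = psbGo [] [] π

IsPermClass : (List ℕ → Set) → Set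
IsPermClass C = ∀ π σ → IsPerm π → IsPerm σ → C π → Contains π σ → C σ

PsbPreimageAv : List ℕ → List ℕ → Set
PsbPreimageAv ρ π = IsPerm π × Avoids (psb π) ρ

-- With α = β a, the permutation σ = n β (n-1) a is sent by PSB to β a (n-1) n = ρ,
-- so σ is not in psb⁻¹(Av ρ).  Inserting n+1 after β gives π = n β (n+1) (n-1) a,
-- which contains σ; in π the entry n+1 pops n, and n-1 and a are bypassed, so
-- psb(π) = β n (n-1) a (n+1).  The last two entries of ρ form an ascent above all
-- earlier ones, so an occurrence of ρ in psb(π) needs |β| + 1 entries lying below
-- a later ascent; none of them can come from n (n-1) a (n+1), which has no
-- increasing triple.  Hence π lies in the set but its pattern σ does not.
module Submission where

open import Defs
open import Data.Nat using (ℕ; _≤_; _∸_)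
open import Data.List using (List; []; _∷_; _++_; map; upTo)
open import Data.List.Relation.Binary.Permutation.Propositional using (_↭_)
open import Relation.Nullary using (¬_)
open import Data.Nat using (suc)

open import Data.Nat using (zero; _<_; z≤n; s≤s; z<s)
open import Data.Nat.Properties
  using (_≟_; _<?_; <-irrefl; <-asym; <-trans; <⇒≤; <⇒≱; ≤-reflexive; n<1+n; n≤1+n; m≤n⇒m≤1+n;
         m≤n⇒m<n∨m≡n; m<m+n; suc-injective; 0≢1+n)
open import Data.List using (length; lookup; [_]; _∷ʳ_; initLast; _∷ʳ′_)
open import Data.List.Properties using (++-assoc; ++-identityʳ; length-++; length-map; length-upTo; upTo-∷ʳ; map-++)
open import Data.List.Relation.Binary.Permutation.Propositional
  using (↭-sym; ↭-trans; ↭-reflexive; module PermutationReasoning)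
open import Data.List.Relation.Binary.Permutation.Propositional.Properties
  using (shift; ∷↭∷ʳ; ↭-reverse; ++⁺ˡ; ++⁺ʳ; ↭-length; All-resp-↭)
open import Data.List.Relation.Binary.Sublist.Propositional as Sublist using (_⊆_; _∷_; ⊆-refl; ⊆-trans)
import Data.List.Relation.Binary.Sublist.Propositional.Properties as Sublistₚ
open import Data.List.Relation.Unary.All as All using (All; []; _∷_)
import Data.List.Relation.Unary.All.Properties as All
open import Data.Fin using (Fin; cast; zero; suc)
open import Data.Fin.Properties using (cast-is-id)
open import Data.Product using (∃; ∃₂; _×_; _,_; proj₁; proj₂)
open import Data.Sum using (inj₁; inj₂)
open import Data.Empty using (⊥; ⊥-elim)
open import Function.Bundles using (_⇔_; mk⇔; Equivalence)
open import Relation.Binary.PropositionalEquality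
  using (_≡_; refl; sym; trans; cong; subst; module ≡-Reasoning)
open import Relation.Nullary using (yes; no)

oneTo : ℕ → List ℕ
oneTo m = map suc (upTo m)

oneTo-suc : ∀ m → oneTo (suc m) ≡ oneTo m ∷ʳ suc m
oneTo-suc m = trans (cong (map suc) (sym (upTo-∷ʳ m))) (map-++ suc (upTo m) [ m ])

oneTo-bounded : ∀ m → All (_≤ m) (oneTo m)
oneTo-bounded m = All.map⁺ (All.all-upTo m)

↭-oneTo-length : ∀ {xs m} → xs ↭ oneTo m → length xs ≡ m
↭-oneTo-length {m = m} p = trans (↭-length p) (trans (length-map suc (upTo m)) (length-upTo m))

↭-oneTo-bounded : ∀ {xs m} → xs ↭ oneTo m → All (_≤ m) xs
↭-oneTo-bounded {m = m} p = All-resp-↭ (↭-sym p) (oneTo-bounded m)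

↭-oneTo⇒IsPerm : ∀ {xs m} → xs ↭ oneTo m → IsPerm xs
↭-oneTo⇒IsPerm {xs} p = subst (λ k → xs ↭ oneTo k) (sym (↭-oneTo-length p)) p

↭-oneTo-∷ʳ : ∀ {xs m} → xs ↭ oneTo m → xs ∷ʳ suc m ↭ oneTo (suc m)
↭-oneTo-∷ʳ {m = m} p = ↭-trans (++⁺ʳ [ suc m ] p) (↭-reflexive (sym (oneTo-suc m)))

insert↭∷ʳ : ∀ (xs : List ℕ) x ys → xs ++ x ∷ ys ↭ (xs ++ ys) ∷ʳ x
insert↭∷ʳ xs x ys = ↭-trans (shift x xs ys) (∷↭∷ʳ x (xs ++ ys))

psbGo-push : ∀ {x t st out xs} → suc x ≡ t →
  psbGo (t ∷ st) out (x ∷ xs) ≡ psbGo (x ∷ t ∷ st) out xs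
psbGo-push {x} {t} e with suc x ≟ t
... | yes _ = refl
... | no ne = ⊥-elim (ne e)

psbGo-bypass : ∀ {x t st out xs} → suc x < t →
  psbGo (t ∷ st) out (x ∷ xs) ≡ psbGo (t ∷ st) (out ∷ʳ x) xs
psbGo-bypass {x} {t} lt with suc x ≟ t
... | yes e = ⊥-elim (<-irrefl e lt)
... | no _ with suc x <? t
...   | yes _ = refl
...   | no ¬lt = ⊥-elim (¬lt lt)

psbGo-pop : ∀ {x t st out xs} → t ≤ x →
  psbGo (t ∷ st) out (x ∷ xs) ≡ psbGo [ x ] (out ++ t ∷ st) xs
psbGo-pop {x} {t} t≤x with suc x ≟ t
... | yes e = ⊥-elim (<⇒≱ (≤-reflexive e) t≤x)
... | no _ with suc x <? t
...   | yes lt = ⊥-elim (<⇒≱ (<⇒≤ lt) t≤x)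
...   | no _ = refl

psbGo-bypass-all : ∀ {t st} out ys xs → All (λ y → suc y < t) ys →
  psbGo (t ∷ st) out (ys ++ xs) ≡ psbGo (t ∷ st) (out ++ ys) xs
psbGo-bypass-all {t} {st} out [] xs [] = cong (λ o → psbGo (t ∷ st) o xs) (sym (++-identityʳ out))
psbGo-bypass-all {t} {st} out (y ∷ ys) xs (lt ∷ lts) = begin
  psbGo (t ∷ st) out (y ∷ ys ++ xs)          ≡⟨ psbGo-bypass lt ⟩
  psbGo (t ∷ st) (out ∷ʳ y) (ys ++ xs)       ≡⟨ psbGo-bypass-all (out ∷ʳ y) ys xs lts ⟩
  psbGo (t ∷ st) ((out ∷ʳ y) ++ ys) xs       ≡⟨ cong (λ o → psbGo (t ∷ st) o xs) (++-assoc out [ y ] ys) ⟩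
  psbGo (t ∷ st) (out ++ y ∷ ys) xs          ∎
  where open ≡-Reasoning

-- Whether the last entry is pushed or bypassed, it ends up just before the stack.
psbGo-last : ∀ {x t st} out → x < t → psbGo (t ∷ st) out [ x ] ≡ out ++ x ∷ t ∷ st
psbGo-last {x} {t} {st} out x<t with m≤n⇒m<n∨m≡n x<t
... | inj₁ lt = trans (psbGo-bypass lt) (++-assoc out [ x ] (t ∷ st))
... | inj₂ eq = psbGo-push eq

OrderIso-refl : ∀ xs → OrderIso xs xs
OrderIso-refl xs = refl , same
  where
  same : ∀ i j → (lookup xs i < lookup xs j) ⇔ (lookup xs (cast refl i) < lookup xs (cast refl j))
  same i j rewrite cast-is-id refl i | cast-is-id refl j = mk⇔ (λ h → h) (λ h → h)

OrderIso-tail : ∀ {x y xs ys} → OrderIso (x ∷ xs) (y ∷ ys) → OrderIso xs ys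
OrderIso-tail (eq , iso) = suc-injective eq , λ i j → iso (suc i) (suc j)

⊆⇒Contains : ∀ {π σ} → σ ⊆ π → Contains π σ
⊆⇒Contains {σ = σ} σ⊆π = σ , σ⊆π , OrderIso-refl σ

midIndex : ∀ (p : List ℕ) y zs → Fin (length (p ++ y ∷ zs))
midIndex []      y zs = zero
midIndex (_ ∷ p) y zs = suc (midIndex p y zs)

lookup-midIndex : ∀ (p : List ℕ) y zs → lookup (p ++ y ∷ zs) (midIndex p y zs) ≡ y
lookup-midIndex []      y zs = refl
lookup-midIndex (_ ∷ p) y zs = lookup-midIndex p y zs

lookup-cast-midIndex : ∀ (p q : List ℕ) {y zs u ws} → length p ≡ length q →
  .(eq : length (p ++ y ∷ zs) ≡ length (q ++ u ∷ ws)) →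
  lookup (q ++ u ∷ ws) (cast eq (midIndex p y zs)) ≡ u
lookup-cast-midIndex []      []      _   _  = refl
lookup-cast-midIndex (_ ∷ p) (_ ∷ q) len eq =
  lookup-cast-midIndex p q (suc-injective len) (suc-injective eq)

TopAscent : List ℕ → ℕ → ℕ → Set
TopAscent p y z = All (_< y) p × y < z

OrderIso-TopAscent : ∀ (p q : List ℕ) {y z u v} → length p ≡ length q →
  OrderIso (p ++ y ∷ z ∷ []) (q ++ u ∷ v ∷ []) → TopAscent q u v → TopAscent p y z
OrderIso-TopAscent []      []      _   (_ , iso) (_ , u<v) = [] , Equivalence.from (iso zero (suc zero)) u<v
OrderIso-TopAscent (x ∷ p) (c ∷ q) {y} {z} {u} {v} len iso@(eq , order) (c<u ∷ q<u , u<v) =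
  x<y ∷ proj₁ ih , proj₂ ih
  where
  ih : TopAscent p y z
  ih = OrderIso-TopAscent p q (suc-injective len) (OrderIso-tail iso) (q<u , u<v)
  c<image-of-y : c < lookup (q ++ u ∷ v ∷ []) (cast (suc-injective eq) (midIndex p y (z ∷ [])))
  c<image-of-y = subst (c <_) (sym (lookup-cast-midIndex p q (suc-injective len) (suc-injective eq))) c<u
  x<y : x < y
  x<y = subst (x <_) (lookup-midIndex p y (z ∷ []))
          (Equivalence.from (order zero (suc (midIndex p y (z ∷ [])))) c<image-of-y)
OrderIso-TopAscent []      (_ ∷ _) () _ _
OrderIso-TopAscent (_ ∷ _) []      () _ _

splitLastTwo : ∀ (s q : List ℕ) {u v} → length s ≡ length (q ++ u ∷ v ∷ []) →
  ∃₂ λ p y → ∃ λ z → s ≡ p ++ y ∷ z ∷ [] × length p ≡ length q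
splitLastTwo (y ∷ z ∷ [])    []      _   = [] , y , z , refl , refl
splitLastTwo []              []      ()
splitLastTwo (_ ∷ [])        []      ()
splitLastTwo (_ ∷ _ ∷ _ ∷ _) []      ()
splitLastTwo []              (_ ∷ _) ()
splitLastTwo (x ∷ s)         (_ ∷ q) len with splitLastTwo s q (suc-injective len)
... | p , y , z , refl , lp = x ∷ p , y , z , refl , cong suc lp

NoIncreasingTriple : List ℕ → Set
NoIncreasingTriple τ = ∀ {x y z} → x ∷ y ∷ z ∷ [] ⊆ τ → x < y → y < z → ⊥

noIncreasingTriple-desc3 : ∀ {a b c d} → b < a → c < b → NoIncreasingTriple (a ∷ b ∷ c ∷ d ∷ [])
noIncreasingTriple-desc3 b<a c<b (refl ∷ refl ∷ _)         x<y _ = <-asym x<y b<a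
noIncreasingTriple-desc3 b<a c<b (refl ∷ _ Sublist.∷ʳ refl ∷ _) x<y _ = <-asym x<y (<-trans c<b b<a)
noIncreasingTriple-desc3 b<a c<b (_ Sublist.∷ʳ refl ∷ refl ∷ _) x<y _ = <-asym x<y c<b
noIncreasingTriple-desc3 b<a c<b (refl ∷ _ Sublist.∷ʳ _ Sublist.∷ʳ refl ∷ ())
noIncreasingTriple-desc3 b<a c<b (_ Sublist.∷ʳ refl ∷ _ Sublist.∷ʳ refl ∷ ())
noIncreasingTriple-desc3 b<a c<b (_ Sublist.∷ʳ _ Sublist.∷ʳ refl ∷ refl ∷ ())
noIncreasingTriple-desc3 b<a c<b (_ Sublist.∷ʳ _ Sublist.∷ʳ refl ∷ _ Sublist.∷ʳ ())
noIncreasingTriple-desc3 b<a c<b (_ Sublist.∷ʳ _ Sublist.∷ʳ _ Sublist.∷ʳ refl ∷ ())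
noIncreasingTriple-desc3 b<a c<b (_ Sublist.∷ʳ _ Sublist.∷ʳ _ Sublist.∷ʳ _ Sublist.∷ʳ ())

-- An entry of the prefix taken from τ would form an increasing triple with y and z.
TopAscent-⊆-length≤ : ∀ {τ} → NoIncreasingTriple τ → ∀ (β p : List ℕ) {y z} →
  TopAscent p y z → p ++ y ∷ z ∷ [] ⊆ β ++ τ → length p ≤ length β
TopAscent-⊆-length≤ free []      []      _               _   = z≤n
TopAscent-⊆-length≤ free []      (x ∷ p) (x<y ∷ _ , y<z) occ =
  ⊥-elim (free (⊆-trans (refl ∷ Sublistₚ.++⁺ˡ p ⊆-refl) occ) x<y y<z)
TopAscent-⊆-length≤ free (_ ∷ β) []      _               _   = z≤n
TopAscent-⊆-length≤ free (_ ∷ β) (x ∷ p) asc (_ Sublist.∷ʳ occ) =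
  m≤n⇒m≤1+n (TopAscent-⊆-length≤ free β (x ∷ p) asc occ)
TopAscent-⊆-length≤ free (_ ∷ β) (x ∷ p) (_ ∷ p<y , y<z) (refl ∷ occ) =
  s≤s (TopAscent-⊆-length≤ free β p (p<y , y<z) occ)

TopAscent-avoids : ∀ {τ α u v} (β : List ℕ) → NoIncreasingTriple τ → TopAscent α u v →
  length β < length α → Avoids (β ++ τ) (α ++ u ∷ v ∷ [])
TopAscent-avoids {α = α} β free asc β<α (s , occ , iso@(len , _))
  with splitLastTwo s α len
... | p , y , z , refl , p≡α =
  <⇒≱ β<α (subst (_≤ length β) p≡α
    (TopAscent-⊆-length≤ free β p (OrderIso-TopAscent p α p≡α iso asc) occ))

psbPreimageAv-notPermClass : ∀ N (β : List ℕ) a → β ∷ʳ a ↭ oneTo N →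
  ¬ IsPermClass (PsbPreimageAv ((β ∷ʳ a) ++ suc N ∷ suc (suc N) ∷ []))
psbPreimageAv-notPermClass N β a perm isClass =
  proj₂ σ∈C (subst (λ w → Contains w ρ) (sym psb-σ) (⊆⇒Contains ⊆-refl))
  where
  n = suc (suc N)
  σ = n ∷ β ++ suc N ∷ a ∷ []
  π = n ∷ β ++ suc n ∷ suc N ∷ a ∷ []
  ρ = (β ∷ʳ a) ++ suc N ∷ n ∷ []

  α≤N : All (_≤ N) (β ∷ʳ a)
  α≤N = ↭-oneTo-bounded perm
  a≤N : a ≤ N
  a≤N with All.++⁻ʳ β α≤N
  ... | a≤N ∷ [] = a≤N
  β-bypassed : All (λ b → suc b < n) β
  β-bypassed = All.map (λ b≤N → s≤s (s≤s b≤N)) (All.++⁻ˡ β α≤N)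

  psb-σ : psb σ ≡ ρ
  psb-σ = begin
    psbGo [ n ] [] (β ++ suc N ∷ a ∷ [])    ≡⟨ psbGo-bypass-all [] β _ β-bypassed ⟩
    psbGo [ n ] β (suc N ∷ a ∷ [])           ≡⟨ psbGo-push {suc N} {n} {[]} {β} {[ a ]} refl ⟩
    psbGo (suc N ∷ n ∷ []) β [ a ]           ≡⟨ psbGo-last β (s≤s a≤N) ⟩
    β ++ a ∷ suc N ∷ n ∷ []                  ≡⟨ ++-assoc β [ a ] _ ⟨
    ρ                                        ∎
    where open ≡-Reasoning

  psb-π : psb π ≡ β ++ n ∷ suc N ∷ a ∷ suc n ∷ []
  psb-π = begin
    psbGo [ n ] [] (β ++ suc n ∷ suc N ∷ a ∷ [])    ≡⟨ psbGo-bypass-all [] β _ β-bypassed ⟩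
    psbGo [ n ] β (suc n ∷ suc N ∷ a ∷ [])           ≡⟨ psbGo-pop (n≤1+n n) ⟩
    psbGo [ suc n ] (β ∷ʳ n) (suc N ∷ a ∷ [])        ≡⟨ psbGo-bypass-all (β ∷ʳ n) (suc N ∷ a ∷ []) [] tail-bypassed ⟩
    ((β ∷ʳ n) ++ suc N ∷ a ∷ []) ∷ʳ suc n            ≡⟨ ++-assoc (β ∷ʳ n) _ _ ⟩
    (β ∷ʳ n) ++ suc N ∷ a ∷ suc n ∷ []               ≡⟨ ++-assoc β [ n ] _ ⟩
    β ++ n ∷ suc N ∷ a ∷ suc n ∷ []                  ∎
    where
    open ≡-Reasoning
    tail-bypassed : All (λ b → suc b < suc n) (suc N ∷ a ∷ [])
    tail-bypassed = n<1+n n ∷ s≤s (s≤s (m≤n⇒m≤1+n a≤N)) ∷ []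

  ρ-perm : ρ ↭ oneTo n
  ρ-perm = ↭-trans (↭-reflexive (sym (++-assoc (β ∷ʳ a) [ suc N ] [ n ])))
                   (↭-oneTo-∷ʳ (↭-oneTo-∷ʳ perm))

  σ-perm : σ ↭ oneTo n
  σ-perm = begin
    n ∷ β ++ suc N ∷ a ∷ []    ↭⟨ shift n β (suc N ∷ a ∷ []) ⟨
    β ++ n ∷ suc N ∷ a ∷ []    ↭⟨ ++⁺ˡ β (↭-reverse (n ∷ suc N ∷ a ∷ [])) ⟨
    β ++ a ∷ suc N ∷ n ∷ []    ≡⟨ ++-assoc β [ a ] _ ⟨
    ρ                          ↭⟨ ρ-perm ⟩
    oneTo n                    ∎
    where open PermutationReasoning

  π-perm : π ↭ oneTo (suc n)
  π-perm = ↭-trans (insert↭∷ʳ (n ∷ β) (suc n) (suc N ∷ a ∷ [])) (↭-oneTo-∷ʳ σ-perm)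

  π-avoids : Avoids (psb π) ρ
  π-avoids = subst (λ w → Avoids w ρ) (sym psb-π)
    (TopAscent-avoids β (noIncreasingTriple-desc3 (n<1+n (suc N)) (s≤s a≤N))
      (All.map s≤s α≤N , n<1+n (suc N))
      (subst (length β <_) (sym (length-++ β)) (m<m+n (length β) z<s)))

  σ∈C : PsbPreimageAv ρ σ
  σ∈C = isClass π σ (↭-oneTo⇒IsPerm π-perm) (↭-oneTo⇒IsPerm σ-perm)
    (↭-oneTo⇒IsPerm π-perm , π-avoids)
    (⊆⇒Contains (Sublistₚ.++⁺ (⊆-refl {x = n ∷ β}) (suc n Sublist.∷ʳ ⊆-refl)))

mainTheorem11 : (n : ℕ) → 4 ≤ n → (α : List ℕ) → α ↭ map suc (upTo (n ∸ 2)) →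
    ¬ IsPermClass (PsbPreimageAv (α ++ (n ∸ 1) ∷ n ∷ []))
mainTheorem11 (suc (suc (suc (suc k)))) (s≤s (s≤s (s≤s (s≤s _)))) α perm with initLast α
... | []       = ⊥-elim (0≢1+n (↭-oneTo-length perm))
... | β ∷ʳ′ a  = psbPreimageAv-notPermClass (suc (suc k)) β a perm
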